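{- Let $\Gamma$ be a nested sequent, $p$ an atomic proposition, and $A_p(\Gamma)$ a multiformula with $\mathcal{L}(A_p(\Gamma))\subseteq\mathcal{L}(\Gamma)$. If $\Gamma$ and $A_p(\Gamma)$ satisfy condition (iii)$'$: for every $\mathsf{L}$-model $\mathcal{M}$ and multiworld interpretation $\mathcal{I}$ of $\Gamma$ into $\mathcal{M}$ with $\mathcal{M},\mathcal{I}\not\models A_p(\Gamma)$ there are an $\mathsf{L}$-model $\mathcal{M}'$ and a multiworld interpretation $\mathcal{I}'$ of $\Gamma$ into $\mathcal{M}'$ with $(\mathcal{M}',\mathcal{I}')\sim_p(\mathcal{M},\mathcal{I})$ and $\mathcal{M}',\mathcal{I}'\not\models\Gamma$, then they satisfy condition (iii): for every nested sequent $\Sigma$ with $p\notin\mathit{Var}(\Sigma)$ and $\mathcal{L}(\Sigma)=\mathcal{L}(\Gamma)$ and every multiworld interpretation $\mathcal{I}$ of $\Gamma$ into an $\mathsf{L}$-model $\mathcal{M}$, if $\mathcal{M},\mathcal{I}\not\models A_p(\Gamma)$ and $\mathcal{M},\mathcal{I}\not\models\Sigma$, then $\mathcal{M}',\mathcal{I}'\not\models\Gamma$ and $\mathcal{M}',\mathcal{I}'\not\models\Sigma$ for some multiworld interpretation $\mathcal{I}'$ of $\Gamma$ into some $\mathsf{L}$-model $\mathcal{M}'$.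
   Context: $\mathsf{L}\in\{\mathsf{K},\mathsf{D},\mathsf{T}\}$ with $\mathsf{L}$-models finite intransitive Kripke trees (irreflexive, serial, resp. reflexive). Nested sequents $\varphi_1,\dots,\varphi_n,[\Gamma_1],\dots,[\Gamma_m]$ have nodes labelled by finite sequences of naturals (root $1$, box $i$ inside $\sigma$ is $\sigma*i$); $\mathcal{L}(\Gamma)$ is the label set, $\sigma:\varphi\in\Gamma$ means $\varphi$ occurs at node $\sigma$, and $\mathit{Var}(X)$ is the set of atoms occurring in $X$. A multiworld interpretation of $\Gamma$ into $\mathcal{M}=(W,R,V)$ is $\mathcal{I}:\mathcal{L}(\Gamma)\to W$ with $\mathcal{I}(\sigma)R\,\mathcal{I}(\sigma*n)$; $\mathcal{M},\mathcal{I}\models\Gamma$ iff $\mathcal{M},\mathcal{I}(\sigma)\models\varphi$ for some $\sigma:\varphi\in\Gamma$. Multiformulas: $\mho::=\sigma:\varphi\mid(\mho\curlywedge\mho)\mid(\mho\curlyvee\mho)$, with $\curlywedge$ multiformula conjunction and $\curlyvee$ multiformula disjunction interpreted classically, $\mathcal{M},\mathcal{I}\models\sigma:\varphi$ iff $\mathcal{M},\mathcal{I}(\sigma)\models\varphi$. $(\mathcal{M},\mathcal{I})\sim_p(\mathcal{M}',\mathcal{I}')$ means there is a bisimulation up to $p$ between $\mathcal{M}$ and $\mathcal{M}'$ (nonempty relation $Z$ whose related worlds agree on all atoms other than $p$ and satisfying forth and back) with $\mathcal{I}(\sigma)Z\mathcal{I}'(\sigma)$ for all labels $\sigma$. -}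

module Defs where

open import Data.Nat using (ℕ; zero; suc)
open import Data.Bool using (Bool; true; false)
open import Data.Fin using (Fin)
open import Data.List using (List; []; _∷_; _++_; [_])
open import Data.List.Membership.Propositional using (_∈_)
open import Data.Product using (Σ; ∃; _×_; _,_)
open import Data.Sum using (_⊎_)
open import Relation.Binary.PropositionalEquality using (_≡_; _≢_)
open import Relation.Nullary using (¬_)
open import Data.Unit using (⊤)
open import Data.Empty using (⊥)

-- Modal formulas (negation normal form, atoms indexed by ℕ)

data Fm : Set where
  atom  : ℕ → Fm
  natom : ℕ → Fm
  ⊤ᶠ ⊥ᶠ : Fm
  _∧ᶠ_ _∨ᶠ_ : Fm → Fm → Fm
  □ᶠ ◇ᶠ : Fm → Fm

data OccursIn (p : ℕ) : Fm → Set where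
  o-atom  : OccursIn p (atom p)
  o-natom : OccursIn p (natom p)
  o-∧l : ∀ {φ ψ} → OccursIn p φ → OccursIn p (φ ∧ᶠ ψ)
  o-∧r : ∀ {φ ψ} → OccursIn p ψ → OccursIn p (φ ∧ᶠ ψ)
  o-∨l : ∀ {φ ψ} → OccursIn p φ → OccursIn p (φ ∨ᶠ ψ)
  o-∨r : ∀ {φ ψ} → OccursIn p ψ → OccursIn p (φ ∨ᶠ ψ)
  o-□  : ∀ {φ} → OccursIn p φ → OccursIn p (□ᶠ φ)
  o-◇  : ∀ {φ} → OccursIn p φ → OccursIn p (◇ᶠ φ)

record Model : Set₁ where
  field
    size : ℕ
    R    : Fin size → Fin size → Set
    V    : Fin size → ℕ → Bool

  W : Set
  W = Fin size

open Model public

-- Finite intransitive Kripke tree: apart from possible reflexive loops,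
-- R is exactly the edge relation of a rooted tree.
record IsIntransTree (M : Model) : Set where
  field
    root        : W M
    depth       : W M → ℕ
    depth-root  : depth root ≡ 0
    root-no-pred : ∀ u → R M u root → u ≡ root
    parent      : ∀ w → w ≢ root →
                  Σ (W M) λ u → u ≢ w × R M u w × (∀ v → v ≢ w → R M v w → v ≡ u)
    depth-step  : ∀ u w → u ≢ w → R M u w → depth w ≡ suc (depth u)

data Logic : Set where
  K D T : Logic

FrameCond : Logic → Model → Set
FrameCond K M = ∀ w → ¬ R M w w
FrameCond D M = ∀ w → Σ (W M) λ v → R M w v
FrameCond T M = ∀ w → R M w w

IsLModel : Logic → Model → Set
IsLModel L M = IsIntransTree M × FrameCond L M

_,_⊨_ : (M : Model) → W M → Fm → Set
M , w ⊨ atom q  = V M w q ≡ true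
M , w ⊨ natom q = V M w q ≡ false
M , w ⊨ ⊤ᶠ = ⊤
M , w ⊨ ⊥ᶠ = ⊥
M , w ⊨ (φ ∧ᶠ ψ) = (M , w ⊨ φ) × (M , w ⊨ ψ)
M , w ⊨ (φ ∨ᶠ ψ) = (M , w ⊨ φ) ⊎ (M , w ⊨ ψ)
M , w ⊨ □ᶠ φ = ∀ v → R M w v → M , v ⊨ φ
M , w ⊨ ◇ᶠ φ = Σ (W M) λ v → R M w v × (M , v ⊨ φ)

-- Nested sequents  φ₁,…,φₙ,[Γ₁],…,[Γₘ]

data Seq : Set where
  seq : List Fm → List Seq → Seq

-- ChildAt bs i c : c is the i-th box of bs (1-based)
data ChildAt : List Seq → ℕ → Seq → Set where
  c-here  : ∀ {b bs} → ChildAt (b ∷ bs) 1 b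
  c-there : ∀ {b bs n c} → ChildAt bs (suc n) c → ChildAt (b ∷ bs) (suc (suc n)) c

data NodeRel : Seq → List ℕ → Set where
  n-here  : ∀ {fs bs} → NodeRel (seq fs bs) []
  n-there : ∀ {fs bs i c π} → ChildAt bs i c → NodeRel c π → NodeRel (seq fs bs) (i ∷ π)

data AtRel : Seq → List ℕ → Fm → Set where
  a-here  : ∀ {fs bs φ} → φ ∈ fs → AtRel (seq fs bs) [] φ
  a-there : ∀ {fs bs i c π φ} → ChildAt bs i c → AtRel c π φ → AtRel (seq fs bs) (i ∷ π) φ

-- labels: root is 1, box i inside σ is σ * i = σ ++ [ i ]
_*ℓ_ : List ℕ → ℕ → List ℕ
σ *ℓ i = σ ++ [ i ]

Lab : Seq → List ℕ → Set
Lab Γ σ = Σ (List ℕ) λ π → σ ≡ 1 ∷ π × NodeRel Γ π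

_∋_∶_ : Seq → List ℕ → Fm → Set
Γ ∋ σ ∶ φ = Σ (List ℕ) λ π → σ ≡ 1 ∷ π × AtRel Γ π φ

NotInVar : ℕ → Seq → Set
NotInVar p Γ = ∀ σ φ → Γ ∋ σ ∶ φ → ¬ OccursIn p φ

SameLabels : Seq → Seq → Set
SameLabels Γ Σ' = ∀ σ → (Lab Γ σ → Lab Σ' σ) × (Lab Σ' σ → Lab Γ σ)

-- Multiworld interpretations (as total maps on labels; only the values
-- on 𝓛(Γ) matter)

Interp : Model → Set
Interp M = List ℕ → W M

IsMWI : (Γ : Seq) (M : Model) → Interp M → Set
IsMWI Γ M I = ∀ σ n → Lab Γ σ → Lab Γ (σ *ℓ n) → R M (I σ) (I (σ *ℓ n))

_,_⊨ˢ_ : (M : Model) → Interp M → Seq → Set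
M , I ⊨ˢ Γ = Σ (List ℕ) λ σ → Σ Fm λ φ → Γ ∋ σ ∶ φ × (M , I σ ⊨ φ)

data MF : Set where
  _∶ᵐ_ : List ℕ → Fm → MF
  _⋏_ _⋎_ : MF → MF → MF

LabMF : MF → List ℕ → Set
LabMF (σ ∶ᵐ φ) τ = τ ≡ σ
LabMF (A ⋏ B) τ = LabMF A τ ⊎ LabMF B τ
LabMF (A ⋎ B) τ = LabMF A τ ⊎ LabMF B τ

_,_⊨ᵐ_ : (M : Model) → Interp M → MF → Set
M , I ⊨ᵐ (σ ∶ᵐ φ) = M , I σ ⊨ φ
M , I ⊨ᵐ (A ⋏ B) = (M , I ⊨ᵐ A) × (M , I ⊨ᵐ B)
M , I ⊨ᵐ (A ⋎ B) = (M , I ⊨ᵐ A) ⊎ (M , I ⊨ᵐ B)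

record BisimUpTo (p : ℕ) (M M' : Model) (Z : W M → W M' → Set) : Set where
  field
    nonempty : Σ (W M) λ w → Σ (W M') λ w' → Z w w'
    atoms    : ∀ w w' → Z w w' → ∀ q → q ≢ p → V M w q ≡ V M' w' q
    forth    : ∀ w w' v → Z w w' → R M w v → Σ (W M') λ v' → R M' w' v' × Z v v'
    back     : ∀ w w' v' → Z w w' → R M' w' v' → Σ (W M) λ v → R M w v × Z v v'

Bisim~ : ℕ → Seq → (M : Model) → Interp M → (M' : Model) → Interp M' → Set₁
Bisim~ p Γ M I M' I' =
  Σ (W M → W M' → Set) λ Z → BisimUpTo p M M' Z × (∀ σ → Lab Γ σ → Z (I σ) (I' σ))

Cond-iii' : Logic → Seq → ℕ → MF → Set₁
Cond-iii' L Γ p A =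
  ∀ (M : Model) (I : Interp M) → IsLModel L M → IsMWI Γ M I → ¬ (M , I ⊨ᵐ A) →
  Σ Model λ M' → Σ (Interp M') λ I' → IsLModel L M' × IsMWI Γ M' I' ×
    Bisim~ p Γ M' I' M I × ¬ (M' , I' ⊨ˢ Γ)

Cond-iii : Logic → Seq → ℕ → MF → Set₁
Cond-iii L Γ p A =
  ∀ (Σ' : Seq) → NotInVar p Σ' → SameLabels Σ' Γ →
  ∀ (M : Model) (I : Interp M) → IsLModel L M → IsMWI Γ M I →
  ¬ (M , I ⊨ᵐ A) → ¬ (M , I ⊨ˢ Σ') →
  Σ Model λ M' → Σ (Interp M') λ I' → IsLModel L M' × IsMWI Γ M' I' ×
    ¬ (M' , I' ⊨ˢ Γ) × ¬ (M' , I' ⊨ˢ Σ')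

{-# OPTIONS --safe #-}
module Submission where

-- Formulas without p are invariant under bisimulation up to p, and so is a
-- whole sequent Σ with p ∉ Var(Σ) once the two interpretations are related on
-- its labels. Hence the countermodel (M' , I') of Γ given by (iii)' also
-- refutes Σ, because (M , I) does.

open import Defs
open import Data.Nat using (ℕ)
open import Data.Product using (_,_; proj₁)
open import Data.Sum using (inj₁; inj₂)
open import Relation.Binary.PropositionalEquality using (refl; sym; trans)
open import Relation.Nullary using (¬_)

AtRel⇒NodeRel : ∀ {Γ π φ} → AtRel Γ π φ → NodeRel Γ π
AtRel⇒NodeRel (a-here _)    = n-here
AtRel⇒NodeRel (a-there c a) = n-there c (AtRel⇒NodeRel a)

∋⇒Lab : ∀ {Γ σ φ} → Γ ∋ σ ∶ φ → Lab Γ σ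
∋⇒Lab (π , σ≡1∷π , at) = π , σ≡1∷π , AtRel⇒NodeRel at

module _ {p : ℕ} {M M' : Model} {Z : W M → W M' → Set} (B : BisimUpTo p M M' Z) where
  open BisimUpTo B

  ⊨-bisim-invariant : ∀ φ → ¬ OccursIn p φ → ∀ {w w'} → Z w w' → M , w ⊨ φ → M' , w' ⊨ φ
  ⊨-bisim-invariant (atom q)  p∉ {w} {w'} z h = trans (sym (atoms w w' z q λ { refl → p∉ o-atom })) h
  ⊨-bisim-invariant (natom q) p∉ {w} {w'} z h = trans (sym (atoms w w' z q λ { refl → p∉ o-natom })) h
  ⊨-bisim-invariant ⊤ᶠ        p∉ z h = h
  ⊨-bisim-invariant (φ ∧ᶠ ψ)  p∉ z (hφ , hψ) =
    ⊨-bisim-invariant φ (λ o → p∉ (o-∧l o)) z hφ , ⊨-bisim-invariant ψ (λ o → p∉ (o-∧r o)) z hψ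
  ⊨-bisim-invariant (φ ∨ᶠ ψ)  p∉ z (inj₁ hφ) = inj₁ (⊨-bisim-invariant φ (λ o → p∉ (o-∨l o)) z hφ)
  ⊨-bisim-invariant (φ ∨ᶠ ψ)  p∉ z (inj₂ hψ) = inj₂ (⊨-bisim-invariant ψ (λ o → p∉ (o-∨r o)) z hψ)
  ⊨-bisim-invariant (□ᶠ φ)    p∉ {w} {w'} z h v' w'Rv' with back w w' v' z w'Rv'
  ... | v , wRv , zv = ⊨-bisim-invariant φ (λ o → p∉ (o-□ o)) zv (h v wRv)
  ⊨-bisim-invariant (◇ᶠ φ)    p∉ {w} {w'} z (v , wRv , hv) with forth w w' v z wRv
  ... | v' , w'Rv' , zv = v' , w'Rv' , ⊨-bisim-invariant φ (λ o → p∉ (o-◇ o)) zv hv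

  ⊨ˢ-bisim-invariant : ∀ {Σ'} {I : Interp M} {I' : Interp M'} → NotInVar p Σ' →
                       (∀ σ → Lab Σ' σ → Z (I σ) (I' σ)) → M , I ⊨ˢ Σ' → M' , I' ⊨ˢ Σ'
  ⊨ˢ-bisim-invariant p∉Σ' related (σ , φ , σ∶φ , h) =
    σ , φ , σ∶φ , ⊨-bisim-invariant φ (p∉Σ' σ φ σ∶φ) (related σ (∋⇒Lab σ∶φ)) h

lemma7 : (L : Logic) (Γ : Seq) (p : ℕ) (A : MF) →
    (∀ σ → LabMF A σ → Lab Γ σ) →
    Cond-iii' L Γ p A → Cond-iii L Γ p A
lemma7 L Γ p A _ iii' Σ' p∉Σ' sameLabels M I isL isMWI M⊭A M⊭Σ'
  with iii' M I isL isMWI M⊭A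
... | M' , I' , isL' , isMWI' , (Z , B , related) , M'⊭Γ =
  M' , I' , isL' , isMWI' , M'⊭Γ ,
  λ M'⊨Σ' → M⊭Σ' (⊨ˢ-bisim-invariant B p∉Σ'
                    (λ σ σ∈Σ' → related σ (proj₁ (sameLabels σ) σ∈Σ')) M'⊨Σ')
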